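{- Let $k\ge3$, $\ell=5k$, let $V$ be a set of $n$ vertices and $S\subseteq V$ with $n/4\le|S|\le n/2$. Then with probability at least $1-2^{ -3n}$, a $k$-uniform hypergraph $\mathcal H$ chosen uniformly at random from $\mathcal T^{(k)}_{S,n}$ satisfies: for every set $A\subseteq S$ of $\ell$ vertices there are at least $n/8$ vertices $v\in V\setminus S$ with $N(v,A)\ne\emptyset$, and for every set $B\subseteq V\setminus S$ of $\ell$ vertices there are at least $n/8$ vertices $v\in S$ with $N(v,B)\neq\emptyset$.
   Context: $\mathcal T^{(k)}_{S,n}$ is the set of all $k$-uniform hypergraphs on $V$ all of whose edges intersect both $S$ and $V\setminus S$; a uniform element is obtained by including each $k$-subset of $V$ meeting both $S$ and $V\setminus S$ independently with probability $1/2$. For a vertex $v$ and a set $X$, $N(v,X)$ is the set of $(k-1)$-element subsets of $X$ which together with $v$ form an edge of $\mathcal H$. -}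

module Defs where

open import Data.Nat using (ℕ; zero; suc; _*_; _∸_; _≡ᵇ_; _≤ᵇ_)
open import Data.Bool using (Bool; true; false; _∧_; not; if_then_else_)
import Data.Bool as Bool
open import Data.List using (List; []; _∷_; _++_; map; filterᵇ; length; null; allFin)
open import Data.Bool.ListAction using (any; all)
open import Data.Vec using (_∷_; [])
open import Data.Vec.Properties using (≡-dec)
open import Data.Fin using (Fin)
open import Data.Fin.Subset using (Subset; ∣_∣; ∁; _∩_; _∪_; ⁅_⁆)
open import Data.Fin.Subset.Properties using (_⊆?_; _∈?_; nonempty?)
open import Relation.Nullary using (does)

subsets : (n : ℕ) → List (Subset n)
subsets zero    = [] ∷ []
subsets (suc n) = map (false ∷_) (subsets n) ++ map (true ∷_) (subsets n)

sublists : {A : Set} → List A → List (List A)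
sublists []       = [] ∷ []
sublists (x ∷ xs) = sublists xs ++ map (x ∷_) (sublists xs)

Hypergraph : ℕ → Set
Hypergraph n = List (Subset n)

crossing : {n : ℕ} → ℕ → Subset n → Subset n → Bool
crossing k S e = (∣ e ∣ ≡ᵇ k) ∧ does (nonempty? (e ∩ S)) ∧ does (nonempty? (e ∩ ∁ S))

crossingSets : {n : ℕ} → ℕ → Subset n → List (Subset n)
crossingSets {n} k S = filterᵇ (crossing k S) (subsets n)

-- T^(k)_{S,n}: all k-uniform hypergraphs all of whose edges meet S and V \ S
-- (one list entry per hypergraph; uniform distribution = uniform over this list)
T : {n : ℕ} → ℕ → Subset n → List (Hypergraph n)
T k S = sublists (crossingSets k S)

isEdge : {n : ℕ} → Hypergraph n → Subset n → Bool
isEdge H e = any (λ f → does (≡-dec Bool._≟_ f e)) H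

N : {n : ℕ} → ℕ → Hypergraph n → Fin n → Subset n → List (Subset n)
N {n} k H v X = filterᵇ (λ Y → does (Y ⊆? X) ∧ (∣ Y ∣ ≡ᵇ k ∸ 1) ∧ isEdge H (⁅ v ⁆ ∪ Y)) (subsets n)

countNbrs : {n : ℕ} → ℕ → Hypergraph n → Subset n → Subset n → ℕ
countNbrs {n} k H W X = length (filterᵇ (λ v → does (v ∈? W) ∧ not (null (N k H v X))) (allFin n))

sideGood : {n : ℕ} → ℕ → ℕ → Hypergraph n → Subset n → Subset n → Bool
sideGood {n} k ℓ H W₁ W₂ =
  all (λ X → if does (X ⊆? W₁) ∧ (∣ X ∣ ≡ᵇ ℓ) then n ≤ᵇ 8 * countNbrs k H W₂ X else true) (subsets n)

Good : {n : ℕ} → ℕ → Subset n → Hypergraph n → Bool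
Good k S H = sideGood k (5 * k) H S (∁ S) ∧ sideGood k (5 * k) H (∁ S) S

-- Fix a side, say W₁ = S and W₂ = V ∖ S. If H fails for an ℓ-set X ⊆ W₁, let F be the set
-- of v ∈ W₂ with N(v, X) ≠ ∅; then 8|F| < n ≤ 4|W₂|, so G = W₂ ∖ F has more than n/8 vertices,
-- and H contains none of the C(5k, k-1)·|G| ≥ 40|G| > 5n admissible edges made of k-1 vertices
-- of X and one vertex of G. For fixed X and F this happens for at most a 2^-(5n+1) fraction
-- of T, and there are two sides, at most 2^n sets X and 2^n sets F, which leaves 2^-3n.
{-# OPTIONS --safe #-}
module Submission where

open import Defs
open import Data.Bool as Bool using (Bool; true; false; not; _∧_; if_then_else_)
open import Data.Bool.Properties using (T-∧)
open import Data.Bool.ListAction using (all)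
open import Data.Fin using (Fin; zero; suc)
open import Data.Fin.Subset using (Subset; outside; inside; ∣_∣; ∁; _∩_; _∪_; ⁅_⁆; _∈_; _⊆_; Nonempty) renaming (⊥ to ∅)
open import Data.Fin.Subset.Properties using (_⊆?_; x∈∁p⇒x∉p; x∈⁅x⁆; _∈?_; nonempty?; drop-∷-⊆; Empty-unique; ∉⊥; ∣⊥∣≡0; ⊆⊤; p∩q⊆p; p∩q⊆q; x∈p∩q⁺; x∈p∩q⁻; ∣p∩q∣≤∣q∣; ∣p∣≤n; ∣∁p∣≡n∸∣p∣; ∩-inverseˡ; ∩-inverseʳ; ∪-inverseˡ)
open import Data.List using (List; []; _∷_; _++_; map; filterᵇ; length; null)
import Data.List as List
open import Data.List.Properties using (length-++; length-map; filter-++; filter-none)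
open import Data.List.Membership.Propositional using (lose) renaming (_∈_ to _∈ₗ_)
open import Data.List.Membership.Propositional.Properties using (∈-map⁺; ∈-++⁺ˡ; ∈-++⁺ʳ; ∈-filter⁺)
import Data.List.Relation.Unary.All as All
open import Data.List.Relation.Unary.All.Properties using (all⁻)
open import Data.List.Relation.Unary.Any as Any using (Any; here; there)
open import Data.List.Relation.Unary.Any.Properties using (any⁺; ¬Any[])
open import Data.Nat using (ℕ; zero; suc; _+_; _*_; _∸_; _^_; _≤_; _<_; _≡ᵇ_; _≤ᵇ_; z≤n; s≤s; z<s)
open import Data.Nat.Combinatorics using (_C_; nC1≡n; nCk+nC[k+1]≡[n+1]C[k+1])
open import Data.Nat.Properties
open import Data.Nat.Tactic.RingSolver using (solve-∀)
open import Data.Product using (_×_; _,_; proj₁; proj₂; ∃-syntax)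
open import Data.Sum using (_⊎_; inj₁; inj₂; [_,_]′)
open import Data.Vec as Vec using (_∷_; [])
open import Data.Vec.Properties using (≡-dec; lookup∘tabulate; lookup⇒[]=)
open import Function using (_∘_; Equivalence)
open import Relation.Binary.PropositionalEquality
open import Relation.Nullary using (Dec; _because_; does; ¬_; contradiction)
open import Relation.Nullary.Decidable using (T?; dec-true; decidable-stable)
open import Relation.Nullary.Reflects using (invert)

private variable
  A B I : Set
  n : ℕ

T-not⁺ : ∀ {b} → ¬ Bool.T b → Bool.T (not b)
T-not⁺ {false} _  = _
T-not⁺ {true}  ¬t = ¬t _

T-not⁻ : ∀ {b} → Bool.T (not b) → ¬ Bool.T b
T-not⁻ {false} _ ()
T-not⁻ {true}  ()

T-not-if⁻ : ∀ b {c} → Bool.T (not (if b then c else true)) → Bool.T (b ∧ not c)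
T-not-if⁻ true  h = h
T-not-if⁻ false ()

T-not-∧⁻ : ∀ b {c} → Bool.T (not (b ∧ c)) → Bool.T (not b) ⊎ Bool.T (not c)
T-not-∧⁻ false _ = inj₁ _
T-not-∧⁻ true  h = inj₂ h

T-does⁺ : (a? : Dec A) → A → Bool.T (does a?)
T-does⁺ a? a rewrite dec-true a? a = _

T-does⁻ : (a? : Dec A) → Bool.T (does a?) → A
T-does⁻ (true  because [a]) _ = invert [a]
T-does⁻ (false because _)   ()

-- Counting and the union bound

count : (A → Bool) → List A → ℕ
count p xs = length (filterᵇ p xs)

count-++ : ∀ (p : A → Bool) xs ys → count p (xs ++ ys) ≡ count p xs + count p ys
count-++ p xs ys = trans (cong length (filter-++ (T? ∘ p) xs ys)) (length-++ (filterᵇ p xs))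

count-map : ∀ (p : A → Bool) (f : B → A) xs → count p (map f xs) ≡ count (p ∘ f) xs
count-map p f [] = refl
count-map p f (x ∷ xs) with p (f x)
... | true  = cong suc (count-map p f xs)
... | false = count-map p f xs

count-none : ∀ {p : A → Bool} → (∀ x → ¬ Bool.T (p x)) → ∀ xs → count p xs ≡ 0
count-none {p = p} ¬p xs = cong length (filter-none (T? ∘ p) (All.universal ¬p xs))

count-filterᵇ : ∀ {p q : A → Bool} → (∀ x → Bool.T (p x) → Bool.T (q x)) →
                ∀ xs → count p (filterᵇ q xs) ≡ count p xs
count-filterᵇ p⇒q [] = refl
count-filterᵇ {p = p} {q} p⇒q (x ∷ xs) with q x in qx
... | true with p x
...   | true  = cong suc (count-filterᵇ p⇒q xs)
...   | false = count-filterᵇ p⇒q xs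
count-filterᵇ {p = p} {q} p⇒q (x ∷ xs) | false with p x in px
...   | true  = contradiction (subst Bool.T qx (p⇒q x (subst Bool.T (sym px) _))) λ ()
...   | false = count-filterᵇ p⇒q xs

count-⊎ : ∀ {p q r : A → Bool} → (∀ x → Bool.T (p x) → Bool.T (q x) ⊎ Bool.T (r x)) →
          ∀ xs → count p xs ≤ count q xs + count r xs
count-⊎ split [] = z≤n
count-⊎ {p = p} {q} {r} split (x ∷ xs) with p x | q x | r x | split x | count-⊎ split xs
... | false | false | false | _    | ih = ih
... | false | false | true  | _    | ih = ≤-trans ih (+-monoʳ-≤ _ (n≤1+n _))
... | false | true  | false | _    | ih = m≤n⇒m≤1+n ih
... | false | true  | true  | _    | ih = m≤n⇒m≤1+n (≤-trans ih (+-monoʳ-≤ _ (n≤1+n _)))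
... | true  | false | false | F⊎F | _  = [ (λ ()) , (λ ()) ]′ (F⊎F _)
... | true  | false | true  | _    | ih = ≤-trans (s≤s ih) (≤-reflexive (sym (+-suc _ _)))
... | true  | true  | false | _    | ih = s≤s ih
... | true  | true  | true  | _    | ih = s≤s (≤-trans ih (+-monoʳ-≤ _ (n≤1+n _)))

union-bound : ∀ (Q : List I) (event : I → A → Bool) {bad : A → Bool} {M N : ℕ} xs →
              (∀ x → Bool.T (bad x) → Any (λ q → Bool.T (event q x)) Q) →
              (∀ {q} → q ∈ₗ Q → M * count (event q) xs ≤ N) →
              M * count bad xs ≤ length Q * N
union-bound [] event {M = M} xs covered bound =
  ≤-reflexive (trans (cong (M *_) (count-none (λ x → ¬Any[] ∘ covered x) xs)) (*-zeroʳ M))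
union-bound {A = A} (q ∷ Q) event {bad} {M} {N} xs covered bound = begin
  M * count bad xs
    ≤⟨ *-monoʳ-≤ M (count-⊎ split xs) ⟩
  M * (count (event q) xs + count rest xs)
    ≡⟨ *-distribˡ-+ M _ _ ⟩
  M * count (event q) xs + M * count rest xs
    ≤⟨ +-mono-≤ (bound (here refl)) (union-bound Q event {M = M} xs covered′ (bound ∘ there)) ⟩
  N + length Q * N
    ∎
  where
  open ≤-Reasoning
  rest : A → Bool
  rest x = bad x ∧ not (event q x)
  split : ∀ x → Bool.T (bad x) → Bool.T (event q x) ⊎ Bool.T (rest x)
  split x b with event q x
  ... | true  = inj₁ _
  ... | false = inj₂ (Equivalence.from T-∧ (b , _))
  covered′ : ∀ x → Bool.T (rest x) → Any (λ q → Bool.T (event q x)) Q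
  covered′ x r with Equivalence.to T-∧ r
  ... | b , ¬e with covered x b
  ...   | here e  = contradiction e (T-not⁻ ¬e)
  ...   | there c = c

not-all⁻ : ∀ (p : A → Bool) xs → Bool.T (not (all p xs)) → Any (λ x → Bool.T (not (p x))) xs
not-all⁻ p [] ()
not-all⁻ p (x ∷ xs) h with p x in px
... | false = here (subst (Bool.T ∘ not) (sym px) _)
... | true  = there (not-all⁻ p xs h)

∈⇒null≡false : ∀ {x : A} {xs} → x ∈ₗ xs → null xs ≡ false
∈⇒null≡false (here _)  = refl
∈⇒null≡false (there _) = refl

length-sublists : (xs : List A) → length (sublists xs) ≡ 2 ^ length xs
length-sublists [] = refl
length-sublists (x ∷ xs) = begin
  length (sublists xs ++ map (x ∷_) (sublists xs))
    ≡⟨ length-++ (sublists xs) ⟩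
  length (sublists xs) + length (map (x ∷_) (sublists xs))
    ≡⟨ cong (length (sublists xs) +_) (length-map (x ∷_) (sublists xs)) ⟩
  length (sublists xs) + length (sublists xs)
    ≡⟨ cong (λ m → m + m) (length-sublists xs) ⟩
  2 ^ length xs + 2 ^ length xs
    ≡⟨ cong (2 ^ length xs +_) (+-identityʳ _) ⟨
  2 ^ suc (length xs)
    ∎
  where open ≡-Reasoning

avoids : (A → Bool) → List A → Bool
avoids p = all (not ∘ p)

count-avoids-sublists : ∀ (p : A → Bool) E → count (avoids p) (sublists E) * 2 ^ count p E ≡ 2 ^ length E
count-avoids-sublists p [] = refl
count-avoids-sublists p (e ∷ E) = begin
  count (avoids p) (sublists E ++ map (e ∷_) (sublists E)) * 2 ^ count p (e ∷ E)
    ≡⟨ cong (_* 2 ^ count p (e ∷ E)) (trans (count-++ (avoids p) (sublists E) _)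
                                            (cong (a +_) (count-map (avoids p) (e ∷_) (sublists E)))) ⟩
  (a + count (λ H → not (p e) ∧ avoids p H) (sublists E)) * 2 ^ count p (e ∷ E)
    ≡⟨ doubling ⟩
  2 * (a * 2 ^ count p E)
    ≡⟨ cong (2 *_) (count-avoids-sublists p E) ⟩
  2 ^ length (e ∷ E)
    ∎
  where
  open ≡-Reasoning
  a : ℕ
  a = count (avoids p) (sublists E)
  doubling : (a + count (λ H → not (p e) ∧ avoids p H) (sublists E)) * 2 ^ count p (e ∷ E)
           ≡ 2 * (a * 2 ^ count p E)
  doubling with p e
  ... | true  rewrite count-none {p = λ _ → false} (λ _ ()) (sublists E) =
    [a+0][2b]≡2[ab] a (2 ^ count p E)
    where
    [a+0][2b]≡2[ab] : ∀ a b → (a + 0) * (2 * b) ≡ 2 * (a * b)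
    [a+0][2b]≡2[ab] = solve-∀
  ... | false = [a+a]b≡2[ab] a (2 ^ count p E)
    where
    [a+a]b≡2[ab] : ∀ a b → (a + a) * b ≡ 2 * (a * b)
    [a+a]b≡2[ab] = solve-∀

length-subsets : ∀ n → length (subsets n) ≡ 2 ^ n
length-subsets zero = refl
length-subsets (suc n) = begin
  length (map (outside ∷_) (subsets n) ++ map (inside ∷_) (subsets n))
    ≡⟨ length-++ (map (outside ∷_) (subsets n)) ⟩
  length (map (outside ∷_) (subsets n)) + length (map (inside ∷_) (subsets n))
    ≡⟨ cong₂ _+_ (length-map (outside ∷_) (subsets n)) (length-map (inside ∷_) (subsets n)) ⟩
  length (subsets n) + length (subsets n)
    ≡⟨ cong (λ m → m + m) (length-subsets n) ⟩
  2 ^ n + 2 ^ n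
    ≡⟨ cong (2 ^ n +_) (+-identityʳ _) ⟨
  2 ^ suc n
    ∎
  where open ≡-Reasoning

∈-subsets : (p : Subset n) → p ∈ₗ subsets n
∈-subsets [] = here refl
∈-subsets (outside ∷ p) = ∈-++⁺ˡ (∈-map⁺ (outside ∷_) (∈-subsets p))
∈-subsets (inside ∷ p) = ∈-++⁺ʳ _ (∈-map⁺ (inside ∷_) (∈-subsets p))

count-subsets : ∀ (p : Subset (suc n) → Bool) →
                count p (subsets (suc n))
                ≡ count (p ∘ (outside ∷_)) (subsets n) + count (p ∘ (inside ∷_)) (subsets n)
count-subsets {n} p = trans (count-++ p (map (outside ∷_) (subsets n)) _)
                            (cong₂ _+_ (count-map p (outside ∷_) (subsets n)) (count-map p (inside ∷_) (subsets n)))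

∣tabulate∣≡count : ∀ {m} (p : A → Bool) (f : Fin m → A) →
                   ∣ Vec.tabulate (p ∘ f) ∣ ≡ count p (List.tabulate f)
∣tabulate∣≡count {m = zero}  p f = refl
∣tabulate∣≡count {m = suc m} p f with p (f zero)
... | true  = cong suc (∣tabulate∣≡count p (f ∘ suc))
... | false = ∣tabulate∣≡count p (f ∘ suc)

∣p∣≡0⇒p≡∅ : (p : Subset n) → ∣ p ∣ ≡ 0 → p ≡ ∅
∣p∣≡0⇒p≡∅ [] _ = refl
∣p∣≡0⇒p≡∅ (outside ∷ p) ∣p∣≡0 = cong (outside ∷_) (∣p∣≡0⇒p≡∅ p ∣p∣≡0)

∣p∣≡1⇒p≡⁅x⁆ : (p : Subset n) → ∣ p ∣ ≡ 1 → ∃[ x ] p ≡ ⁅ x ⁆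
∣p∣≡1⇒p≡⁅x⁆ (inside ∷ p) ∣p∣≡1 = zero , cong (inside ∷_) (∣p∣≡0⇒p≡∅ p (suc-injective ∣p∣≡1))
∣p∣≡1⇒p≡⁅x⁆ (outside ∷ p) ∣p∣≡1 with ∣p∣≡1⇒p≡⁅x⁆ p ∣p∣≡1
... | x , p≡⁅x⁆ = suc x , cong (outside ∷_) p≡⁅x⁆

0<∣p∣⇒Nonempty : (p : Subset n) → 0 < ∣ p ∣ → Nonempty p
0<∣p∣⇒Nonempty {n} p 0<∣p∣ = decidable-stable (nonempty? p) λ p-empty →
  <⇒≢ 0<∣p∣ (sym (trans (cong ∣_∣ (Empty-unique p-empty)) (∣⊥∣≡0 n)))

Nonempty-∩-monoʳ : ∀ {p q r : Subset n} → q ⊆ r → Nonempty (p ∩ q) → Nonempty (p ∩ r)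
Nonempty-∩-monoʳ {p = p} {q} q⊆r (x , x∈p∩q) =
  let x∈p , x∈q = x∈p∩q⁻ p q x∈p∩q in x , x∈p∩q⁺ (x∈p , q⊆r x∈q)

∩-disjoint-mono : ∀ {p p′ q q′ : Subset n} → p ⊆ p′ → q ⊆ q′ → p′ ∩ q′ ≡ ∅ → p ∩ q ≡ ∅
∩-disjoint-mono {p = p} {q = q} p⊆p′ q⊆q′ p′∩q′≡∅ = Empty-unique λ (x , x∈p∩q) →
  let x∈p , x∈q = x∈p∩q⁻ p q x∈p∩q in ∉⊥ (subst (x ∈_) p′∩q′≡∅ (x∈p∩q⁺ (p⊆p′ x∈p , q⊆q′ x∈q)))

∣p∣≡∣p∩q∣+∣p∩r∣ : (p q r : Subset n) → p ⊆ q ∪ r → q ∩ r ≡ ∅ → ∣ p ∣ ≡ ∣ p ∩ q ∣ + ∣ p ∩ r ∣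
∣p∣≡∣p∩q∣+∣p∩r∣ [] [] [] _ _ = refl
∣p∣≡∣p∩q∣+∣p∩r∣ (outside ∷ p) (_ ∷ q) (_ ∷ r) p⊆q∪r q∩r≡∅ =
  ∣p∣≡∣p∩q∣+∣p∩r∣ p q r (drop-∷-⊆ p⊆q∪r) (cong Vec.tail q∩r≡∅)
∣p∣≡∣p∩q∣+∣p∩r∣ (inside ∷ p) (inside ∷ q) (outside ∷ r) p⊆q∪r q∩r≡∅ =
  cong suc (∣p∣≡∣p∩q∣+∣p∩r∣ p q r (drop-∷-⊆ p⊆q∪r) (cong Vec.tail q∩r≡∅))
∣p∣≡∣p∩q∣+∣p∩r∣ (inside ∷ p) (outside ∷ q) (inside ∷ r) p⊆q∪r q∩r≡∅ =
  trans (cong suc (∣p∣≡∣p∩q∣+∣p∩r∣ p q r (drop-∷-⊆ p⊆q∪r) (cong Vec.tail q∩r≡∅))) (sym (+-suc _ _))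
∣p∣≡∣p∩q∣+∣p∩r∣ (inside ∷ p) (inside ∷ q) (inside ∷ r) _ ()
∣p∣≡∣p∩q∣+∣p∩r∣ (inside ∷ p) (outside ∷ q) (outside ∷ r) p⊆q∪r _ with p⊆q∪r Vec.here
... | ()

p⊆q∪r⇒p≡p∩r∪p∩q : (p q r : Subset n) → p ⊆ q ∪ r → p ≡ (p ∩ r) ∪ (p ∩ q)
p⊆q∪r⇒p≡p∩r∪p∩q [] [] [] _ = refl
p⊆q∪r⇒p≡p∩r∪p∩q (outside ∷ p) (_ ∷ q) (_ ∷ r) p⊆q∪r =
  cong (outside ∷_) (p⊆q∪r⇒p≡p∩r∪p∩q p q r (drop-∷-⊆ p⊆q∪r))
p⊆q∪r⇒p≡p∩r∪p∩q (inside ∷ p) (inside ∷ q) (outside ∷ r) p⊆q∪r =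
  cong (inside ∷_) (p⊆q∪r⇒p≡p∩r∪p∩q p q r (drop-∷-⊆ p⊆q∪r))
p⊆q∪r⇒p≡p∩r∪p∩q (inside ∷ p) (_ ∷ q) (inside ∷ r) p⊆q∪r =
  cong (inside ∷_) (p⊆q∪r⇒p≡p∩r∪p∩q p q r (drop-∷-⊆ p⊆q∪r))
p⊆q∪r⇒p≡p∩r∪p∩q (inside ∷ p) (outside ∷ q) (outside ∷ r) p⊆q∪r with p⊆q∪r Vec.here
... | ()

∣p∣≤∣p∩∁q∣+∣q∣ : (p q : Subset n) → ∣ p ∣ ≤ ∣ p ∩ ∁ q ∣ + ∣ q ∣
∣p∣≤∣p∩∁q∣+∣q∣ p q = begin
  ∣ p ∣                  ≡⟨ ∣p∣≡∣p∩q∣+∣p∩r∣ p (∁ q) q p⊆∁q∪q (∩-inverseˡ q) ⟩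
  ∣ p ∩ ∁ q ∣ + ∣ p ∩ q ∣ ≤⟨ +-monoʳ-≤ ∣ p ∩ ∁ q ∣ (∣p∩q∣≤∣q∣ p q) ⟩
  ∣ p ∩ ∁ q ∣ + ∣ q ∣     ∎
  where
  open ≤-Reasoning
  p⊆∁q∪q : p ⊆ ∁ q ∪ q
  p⊆∁q∪q = subst (p ⊆_) (sym (∪-inverseˡ q)) ⊆⊤

∣p∣+∣∁p∣≡n : (p : Subset n) → ∣ p ∣ + ∣ ∁ p ∣ ≡ n
∣p∣+∣∁p∣≡n p = trans (cong (∣ p ∣ +_) (∣∁p∣≡n∸∣p∣ p)) (m+[n∸m]≡n (∣p∣≤n p))

2∣p∣≤n⇒n≤4∣∁p∣ : (p : Subset n) → 2 * ∣ p ∣ ≤ n → n ≤ 4 * ∣ ∁ p ∣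
2∣p∣≤n⇒n≤4∣∁p∣ {n} p 2∣p∣≤n = begin
  n                ≡⟨ ∣p∣+∣∁p∣≡n p ⟨
  ∣ p ∣ + ∣ ∁ p ∣  ≤⟨ +-mono-≤ ∣p∣≤∣∁p∣ (≤-reflexive (sym (+-identityʳ (∣ ∁ p ∣)))) ⟩
  2 * ∣ ∁ p ∣      ≤⟨ *-monoˡ-≤ (∣ ∁ p ∣) {2} {4} (s≤s (s≤s z≤n)) ⟩
  4 * ∣ ∁ p ∣      ∎
  where
  open ≤-Reasoning
  ∣p∣≤∣∁p∣ : ∣ p ∣ ≤ ∣ ∁ p ∣
  ∣p∣≤∣∁p∣ = subst (_≤ ∣ ∁ p ∣) (+-identityʳ ∣ p ∣)
    (+-cancelˡ-≤ ∣ p ∣ (∣ p ∣ + 0) (∣ ∁ p ∣) (≤-trans 2∣p∣≤n (≤-reflexive (sym (∣p∣+∣∁p∣≡n p)))))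

-- Binomial coefficients

nCk≤[m+n]Ck : ∀ m n k → n C k ≤ (m + n) C k
nCk≤[m+n]Ck zero    n k       = ≤-refl
nCk≤[m+n]Ck (suc m) n zero    = ≤-refl
nCk≤[m+n]Ck (suc m) n (suc k) = begin
  n C suc k                               ≤⟨ nCk≤[m+n]Ck m n (suc k) ⟩
  (m + n) C suc k                         ≤⟨ m≤n+m _ _ ⟩
  (m + n) C k + (m + n) C suc k           ≡⟨ nCk+nC[k+1]≡[n+1]C[k+1] (m + n) k ⟩
  suc (m + n) C suc k                     ∎
  where open ≤-Reasoning

nCk≤[m+n]C[m+k] : ∀ m n k → n C k ≤ (m + n) C (m + k)
nCk≤[m+n]C[m+k] zero    n k = ≤-refl
nCk≤[m+n]C[m+k] (suc m) n k = begin
  n C k                                   ≤⟨ nCk≤[m+n]C[m+k] m n k ⟩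
  (m + n) C (m + k)                       ≤⟨ m≤m+n _ _ ⟩
  (m + n) C (m + k) + (m + n) C suc (m + k) ≡⟨ nCk+nC[k+1]≡[n+1]C[k+1] (m + n) (m + k) ⟩
  suc (m + n) C suc (m + k)               ∎
  where open ≤-Reasoning

40≤[5k]C[k∸1] : ∀ {k} → 3 ≤ k → 40 ≤ (5 * k) C (k ∸ 1)
40≤[5k]C[k∸1] {suc (suc (suc j))} (s≤s (s≤s (s≤s _))) = begin
  40                             ≤⟨ ≤ᵇ⇒≤ 40 (15 C 2) _ ⟩
  15 C 2                         ≤⟨ nCk≤[m+n]Ck (4 * j) 15 2 ⟩
  (4 * j + 15) C 2               ≤⟨ nCk≤[m+n]C[m+k] j (4 * j + 15) 2 ⟩
  (j + (4 * j + 15)) C (j + 2)   ≡⟨ cong₂ _C_ (5[3+j]≡j+[4j+15] j) (+-comm 2 j) ⟨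
  (5 * (3 + j)) C (2 + j)        ∎
  where
  open ≤-Reasoning
  5[3+j]≡j+[4j+15] : ∀ j → 5 * (3 + j) ≡ j + (4 * j + 15)
  5[3+j]≡j+[4j+15] = solve-∀

straddles : Subset n → ℕ → Subset n → ℕ → Subset n → Bool
straddles p a q b e = does (e ⊆? p ∪ q) ∧ (∣ e ∩ p ∣ ≡ᵇ a) ∧ (∣ e ∩ q ∣ ≡ᵇ b)

straddles⁻ : ∀ (p : Subset n) a q b e → Bool.T (straddles p a q b e) →
             e ⊆ p ∪ q × ∣ e ∩ p ∣ ≡ a × ∣ e ∩ q ∣ ≡ b
straddles⁻ p a q b e h =
  let e⊆p∪q , rest = Equivalence.to T-∧ h
      ∣e∩p∣≡a , ∣e∩q∣≡b = Equivalence.to T-∧ rest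
  in T-does⁻ (e ⊆? p ∪ q) e⊆p∪q , ≡ᵇ⇒≡ _ a ∣e∩p∣≡a , ≡ᵇ⇒≡ _ b ∣e∩q∣≡b

count-straddles : ∀ (p q : Subset n) a b → p ∩ q ≡ ∅ →
                  count (straddles p a q b) (subsets n) ≡ (∣ p ∣ C a) * (∣ q ∣ C b)
count-straddles [] [] zero    zero    _ = refl
count-straddles [] [] zero    (suc b) _ = refl
count-straddles [] [] (suc a) b       _ = refl
count-straddles {suc n} (x ∷ p) (y ∷ q) a b x∷p∩y∷q≡∅ = begin
  count (straddles (x ∷ p) a (y ∷ q) b) (subsets (suc n))
    ≡⟨ count-subsets (straddles (x ∷ p) a (y ∷ q) b) ⟩
  count (straddles p a q b) (subsets n) + insides x y a b
    ≡⟨ cong (_+ insides x y a b) (count-straddles p q a b p∩q≡∅) ⟩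
  (∣ p ∣ C a) * (∣ q ∣ C b) + insides x y a b
    ≡⟨ with-head x y a b x∷p∩y∷q≡∅ ⟩
  (∣ x ∷ p ∣ C a) * (∣ y ∷ q ∣ C b)
    ∎
  where
  open ≡-Reasoning
  p∩q≡∅ : p ∩ q ≡ ∅
  p∩q≡∅ = cong Vec.tail x∷p∩y∷q≡∅
  insides : Bool → Bool → ℕ → ℕ → ℕ
  insides x y a b = count (straddles (x ∷ p) a (y ∷ q) b ∘ (inside ∷_)) (subsets n)
  no-insides : ∀ x y a b → (∀ e → ¬ Bool.T (straddles (x ∷ p) a (y ∷ q) b (inside ∷ e))) →
               insides x y a b ≡ 0
  no-insides _ _ _ _ none = count-none none (subsets n)
  pascalʳ : ∀ m k c → (m C suc k) * c + (m C k) * c ≡ (suc m C suc k) * c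
  pascalʳ m k c = trans (sym (*-distribʳ-+ c (m C suc k) (m C k)))
    (cong (_* c) (trans (+-comm (m C suc k) (m C k)) (nCk+nC[k+1]≡[n+1]C[k+1] m k)))
  pascalˡ : ∀ c m k → c * (m C suc k) + c * (m C k) ≡ c * (suc m C suc k)
  pascalˡ c m k = trans (sym (*-distribˡ-+ c (m C suc k) (m C k)))
    (cong (c *_) (trans (+-comm (m C suc k) (m C k)) (nCk+nC[k+1]≡[n+1]C[k+1] m k)))
  with-head : ∀ x y a b → (x ∷ p) ∩ (y ∷ q) ≡ ∅ →
              (∣ p ∣ C a) * (∣ q ∣ C b) + insides x y a b ≡ (∣ x ∷ p ∣ C a) * (∣ y ∷ q ∣ C b)
  with-head inside  inside  a       b       ()
  with-head outside outside a       b       _ =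
    trans (cong ((∣ p ∣ C a) * (∣ q ∣ C b) +_) (no-insides outside outside a b λ _ ())) (+-identityʳ _)
  with-head inside  outside zero    b       _ =
    trans (cong ((∣ p ∣ C 0) * (∣ q ∣ C b) +_) (no-insides inside outside 0 b λ e h →
      0≢1+n (sym (proj₁ (proj₂ (straddles⁻ (inside ∷ p) 0 (outside ∷ q) b (inside ∷ e) h)))))) (+-identityʳ _)
  with-head inside  outside (suc a) b       _ =
    trans (cong ((∣ p ∣ C suc a) * (∣ q ∣ C b) +_) (count-straddles p q a b p∩q≡∅))
          (pascalʳ ∣ p ∣ a (∣ q ∣ C b))
  with-head outside inside  a       zero    _ =
    trans (cong ((∣ p ∣ C a) * 1 +_) (no-insides outside inside a 0 λ e h →
      0≢1+n (sym (proj₂ (proj₂ (straddles⁻ (outside ∷ p) a (inside ∷ q) 0 (inside ∷ e) h)))))) (+-identityʳ _)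
  with-head outside inside  a       (suc b) _ =
    trans (cong ((∣ p ∣ C a) * (∣ q ∣ C suc b) +_) (count-straddles p q a b p∩q≡∅))
          (pascalˡ (∣ p ∣ C a) ∣ q ∣ b)

n≤4[g+f]⇒8f<n⇒n<8g : ∀ {n} g f → n ≤ 4 * (g + f) → 8 * f < n → n < 8 * g
n≤4[g+f]⇒8f<n⇒n<8g {n} g f n≤4[g+f] 8f<n = +-cancelˡ-< n n (8 * g) (begin-strict
  n + n                     ≤⟨ +-mono-≤ n≤4[g+f] n≤4[g+f] ⟩
  4 * (g + f) + 4 * (g + f) ≡⟨ 4[g+f]+4[g+f]≡8g+8f g f ⟩
  8 * g + 8 * f             <⟨ +-monoʳ-< (8 * g) 8f<n ⟩
  8 * g + n                 ≡⟨ +-comm (8 * g) n ⟩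
  n + 8 * g                 ∎)
  where
  open ≤-Reasoning
  4[g+f]+4[g+f]≡8g+8f : ∀ g f → 4 * (g + f) + 4 * (g + f) ≡ 8 * g + 8 * f
  4[g+f]+4[g+f]≡8g+8f = solve-∀

2^[1+5n]≡2*2^n*2^n*2^[3n] : ∀ n → 2 ^ (1 + 5 * n) ≡ 2 * (2 ^ n * (2 ^ n * 2 ^ (3 * n)))
2^[1+5n]≡2*2^n*2^n*2^[3n] n = begin
  2 ^ (1 + 5 * n)                     ≡⟨ cong (λ m → 2 ^ (1 + m)) (5n≡n+[n+3n] n) ⟩
  2 * 2 ^ (n + (n + 3 * n))           ≡⟨ cong (2 *_) (^-distribˡ-+-* 2 n (n + 3 * n)) ⟩
  2 * (2 ^ n * 2 ^ (n + 3 * n))       ≡⟨ cong (λ m → 2 * (2 ^ n * m)) (^-distribˡ-+-* 2 n (3 * n)) ⟩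
  2 * (2 ^ n * (2 ^ n * 2 ^ (3 * n))) ∎
  where
  open ≡-Reasoning
  5n≡n+[n+3n] : ∀ n → 5 * n ≡ n + (n + 3 * n)
  5n≡n+[n+3n] = solve-∀

2^[1+5n]c≤2[2ⁿ[2ⁿL]]⇒2^[3n]c≤L : ∀ n {c L} →
  2 ^ (1 + 5 * n) * c ≤ 2 * (length (subsets n) * (length (subsets n) * L)) → 2 ^ (3 * n) * c ≤ L
2^[1+5n]c≤2[2ⁿ[2ⁿL]]⇒2^[3n]c≤L n {c} {L} h =
  *-cancelˡ-≤ (2 ^ n) {{m^n≢0 2 n}} (*-cancelˡ-≤ (2 ^ n) {{m^n≢0 2 n}} (*-cancelˡ-≤ 2 (begin
    2 * (2 ^ n * (2 ^ n * (2 ^ (3 * n) * c))) ≡⟨ reassociate 2 (2 ^ n) (2 ^ n) (2 ^ (3 * n)) c ⟩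
    2 * (2 ^ n * (2 ^ n * 2 ^ (3 * n))) * c   ≡⟨ cong (_* c) (2^[1+5n]≡2*2^n*2^n*2^[3n] n) ⟨
    2 ^ (1 + 5 * n) * c                       ≤⟨ h ⟩
    2 * (length (subsets n) * (length (subsets n) * L))
                                              ≡⟨ cong (λ m → 2 * (m * (m * L))) (length-subsets n) ⟩
    2 * (2 ^ n * (2 ^ n * L))                 ∎)))
  where
  open ≤-Reasoning
  reassociate : ∀ a b c d e → a * (b * (c * (d * e))) ≡ a * (b * (c * d)) * e
  reassociate = solve-∀

-- Hypergraphs

isEdge⁺ : ∀ {H : Hypergraph n} {e} → e ∈ₗ H → Bool.T (isEdge H e)
isEdge⁺ {e = e} e∈H = any⁺ _ (Any.map (λ {f} e≡f → T-does⁺ (≡-dec Bool._≟_ f e) (sym e≡f)) e∈H)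

∈-N : ∀ k {H : Hypergraph n} {v X Y e} → e ∈ₗ H → e ≡ ⁅ v ⁆ ∪ Y → Y ⊆ X → ∣ Y ∣ ≡ k ∸ 1 → Y ∈ₗ N k H v X
∈-N k {H} {v} {X} {Y} e∈H e≡v∪Y Y⊆X ∣Y∣≡k-1 = ∈-filter⁺ _ (∈-subsets Y)
  (Equivalence.from T-∧ (T-does⁺ (Y ⊆? X) Y⊆X ,
   Equivalence.from T-∧ (≡⇒≡ᵇ _ _ ∣Y∣≡k-1 , subst (Bool.T ∘ isEdge H) e≡v∪Y (isEdge⁺ e∈H))))

neighbourhood : ℕ → Hypergraph n → Subset n → Subset n → Subset n
neighbourhood k H W X = Vec.tabulate λ v → does (v ∈? W) ∧ not (null (N k H v X))

∣neighbourhood∣ : ∀ k (H : Hypergraph n) W X → ∣ neighbourhood k H W X ∣ ≡ countNbrs k H W X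
∣neighbourhood∣ k H W X = ∣tabulate∣≡count (λ v → does (v ∈? W) ∧ not (null (N k H v X))) (λ v → v)

∈-neighbourhood : ∀ k (H : Hypergraph n) {W X Y v} → v ∈ W → Y ∈ₗ N k H v X → v ∈ neighbourhood k H W X
∈-neighbourhood k H {W} {v = v} v∈W Y∈N = lookup⇒[]= v _
  (trans (lookup∘tabulate _ v) (cong₂ _∧_ (dec-true (v ∈? W) v∈W) (cong not (∈⇒null≡false Y∈N))))

links : ℕ → Subset n → Subset n → Subset n → Bool
links k X G = straddles X (k ∸ 1) G 1

avoids-links-outside-neighbourhood : ∀ k (H : Hypergraph n) W X →
  Bool.T (avoids (links k X (W ∩ ∁ (neighbourhood k H W X))) H)
avoids-links-outside-neighbourhood {n} k H W X = all⁻ _ (All.tabulate λ e∈H → T-not⁺ (no-link e∈H))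
  where
  F : Subset n
  F = neighbourhood k H W X
  no-link : ∀ {e} → e ∈ₗ H → ¬ Bool.T (links k X (W ∩ ∁ F) e)
  no-link {e} e∈H link with straddles⁻ X (k ∸ 1) (W ∩ ∁ F) 1 e link
  ... | e⊆X∪G , ∣e∩X∣≡k-1 , ∣e∩G∣≡1 with ∣p∣≡1⇒p≡⁅x⁆ (e ∩ (W ∩ ∁ F)) ∣e∩G∣≡1
  ... | v , e∩G≡⁅v⁆ = x∈∁p⇒x∉p v∈∁F (∈-neighbourhood k H v∈W (∈-N k e∈H e≡v∪e∩X (p∩q⊆q e X) ∣e∩X∣≡k-1))
    where
    v∈G : v ∈ W ∩ ∁ F
    v∈G = proj₂ (x∈p∩q⁻ e _ (subst (v ∈_) (sym e∩G≡⁅v⁆) (x∈⁅x⁆ v)))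
    v∈W : v ∈ W
    v∈W = proj₁ (x∈p∩q⁻ W (∁ F) v∈G)
    v∈∁F : v ∈ ∁ F
    v∈∁F = proj₂ (x∈p∩q⁻ W (∁ F) v∈G)
    e≡v∪e∩X : e ≡ ⁅ v ⁆ ∪ (e ∩ X)
    e≡v∪e∩X = trans (p⊆q∪r⇒p≡p∩r∪p∩q e X _ e⊆X∪G) (cong (_∪ (e ∩ X)) e∩G≡⁅v⁆)

crossing⁺ : ∀ {k} {S e : Subset n} → ∣ e ∣ ≡ k → Nonempty (e ∩ S) → Nonempty (e ∩ ∁ S) →
            Bool.T (crossing k S e)
crossing⁺ {S = S} {e} ∣e∣≡k e∩S≢∅ e∩∁S≢∅ = Equivalence.from T-∧ (≡⇒≡ᵇ _ _ ∣e∣≡k ,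
  Equivalence.from T-∧ (T-does⁺ (nonempty? (e ∩ S)) e∩S≢∅ , T-does⁺ (nonempty? (e ∩ ∁ S)) e∩∁S≢∅))

module SideBound {k n : ℕ} (S W₁ W₂ : Subset n) (3≤k : 3 ≤ k) (n≤4∣W₂∣ : n ≤ 4 * ∣ W₂ ∣)
  (W₁∩W₂≡∅ : W₁ ∩ W₂ ≡ ∅)
  (crossing-if-meets : ∀ {e} → ∣ e ∣ ≡ k → Nonempty (e ∩ W₁) → Nonempty (e ∩ W₂) →
                       Bool.T (crossing k S e))
  where

  candidate : Subset n → Bool
  candidate X = does (X ⊆? W₁) ∧ (∣ X ∣ ≡ᵇ 5 * k)

  witnessesFailure : Subset n → Hypergraph n → Bool
  witnessesFailure X H = candidate X ∧ not (n ≤ᵇ 8 * countNbrs k H W₂ X)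

  -- F ranges over all subsets instead of being the neighbourhood of X in H, so that for fixed
  -- X and F the event is the avoidance of a fixed set of edges.
  missesLinks : Subset n → Subset n → Hypergraph n → Bool
  missesLinks X F H = (candidate X ∧ not (n ≤ᵇ 8 * ∣ F ∣)) ∧ avoids (links k X (W₂ ∩ ∁ F)) H

  links⇒crossing : ∀ {X G e} → X ⊆ W₁ → G ⊆ W₂ → Bool.T (links k X G e) → Bool.T (crossing k S e)
  links⇒crossing {X} {G} {e} X⊆W₁ G⊆W₂ link with straddles⁻ X (k ∸ 1) G 1 e link
  ... | e⊆X∪G , ∣e∩X∣≡k∸1 , ∣e∩G∣≡1 = crossing-if-meets ∣e∣≡k
    (Nonempty-∩-monoʳ X⊆W₁ (0<∣p∣⇒Nonempty (e ∩ X) (subst (0 <_) (sym ∣e∩X∣≡k∸1) 0<k∸1)))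
    (Nonempty-∩-monoʳ G⊆W₂ (0<∣p∣⇒Nonempty (e ∩ G) (subst (0 <_) (sym ∣e∩G∣≡1) z<s)))
    where
    0<k∸1 : 0 < k ∸ 1
    0<k∸1 = ≤-trans (s≤s z≤n) (∸-monoˡ-≤ 1 3≤k)
    ∣e∣≡k : ∣ e ∣ ≡ k
    ∣e∣≡k = begin
      ∣ e ∣                 ≡⟨ ∣p∣≡∣p∩q∣+∣p∩r∣ e X G e⊆X∪G (∩-disjoint-mono X⊆W₁ G⊆W₂ W₁∩W₂≡∅) ⟩
      ∣ e ∩ X ∣ + ∣ e ∩ G ∣ ≡⟨ cong₂ _+_ ∣e∩X∣≡k∸1 ∣e∩G∣≡1 ⟩
      k ∸ 1 + 1             ≡⟨ m∸n+n≡m (≤-trans (s≤s z≤n) 3≤k) ⟩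
      k                     ∎
      where open ≡-Reasoning

  5n<count-links : ∀ {X F} → X ⊆ W₁ → ∣ X ∣ ≡ 5 * k → 8 * ∣ F ∣ < n →
                   5 * n < count (links k X (W₂ ∩ ∁ F)) (crossingSets k S)
  5n<count-links {X} {F} X⊆W₁ ∣X∣≡5k 8∣F∣<n = begin-strict
    5 * n                                  <⟨ *-monoʳ-< 5 n<8∣G∣ ⟩
    5 * (8 * ∣ G ∣)                        ≡⟨ *-assoc 5 8 (∣ G ∣) ⟨
    40 * ∣ G ∣                             ≤⟨ *-monoˡ-≤ (∣ G ∣) (40≤[5k]C[k∸1] 3≤k) ⟩
    ((5 * k) C (k ∸ 1)) * ∣ G ∣            ≡⟨ cong₂ (λ x g → (x C (k ∸ 1)) * g) ∣X∣≡5k (nC1≡n ∣ G ∣) ⟨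
    (∣ X ∣ C (k ∸ 1)) * (∣ G ∣ C 1)        ≡⟨ count-straddles X G (k ∸ 1) 1 X∩G≡∅ ⟨
    count (links k X G) (subsets n)        ≡⟨ count-filterᵇ (λ e → links⇒crossing {e = e} X⊆W₁ G⊆W₂) (subsets n) ⟨
    count (links k X G) (crossingSets k S) ∎
    where
    open ≤-Reasoning
    G : Subset n
    G = W₂ ∩ ∁ F
    G⊆W₂ : G ⊆ W₂
    G⊆W₂ = p∩q⊆p W₂ (∁ F)
    X∩G≡∅ : X ∩ G ≡ ∅
    X∩G≡∅ = ∩-disjoint-mono X⊆W₁ G⊆W₂ W₁∩W₂≡∅
    n<8∣G∣ : n < 8 * ∣ G ∣
    n<8∣G∣ = n≤4[g+f]⇒8f<n⇒n<8g (∣ G ∣) (∣ F ∣)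
               (≤-trans n≤4∣W₂∣ (*-monoʳ-≤ 4 (∣p∣≤∣p∩∁q∣+∣q∣ W₂ F))) 8∣F∣<n

  avoids-links-bound : ∀ {X F} → X ⊆ W₁ → ∣ X ∣ ≡ 5 * k → 8 * ∣ F ∣ < n →
    2 ^ (1 + 5 * n) * count (avoids (links k X (W₂ ∩ ∁ F))) (T k S) ≤ length (T k S)
  avoids-links-bound {X} {F} X⊆W₁ ∣X∣≡5k 8∣F∣<n = begin
    2 ^ (1 + 5 * n) * count (avoids linksXG) (T k S)
      ≤⟨ *-monoˡ-≤ _ (^-monoʳ-≤ 2 (5n<count-links X⊆W₁ ∣X∣≡5k 8∣F∣<n)) ⟩
    2 ^ #links * count (avoids linksXG) (T k S)
      ≡⟨ *-comm (2 ^ #links) _ ⟩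
    count (avoids linksXG) (T k S) * 2 ^ #links
      ≡⟨ count-avoids-sublists linksXG (crossingSets k S) ⟩
    2 ^ length (crossingSets k S)
      ≡⟨ length-sublists (crossingSets k S) ⟨
    length (T k S)
      ∎
    where
    open ≤-Reasoning
    linksXG : Subset n → Bool
    linksXG = links k X (W₂ ∩ ∁ F)
    #links : ℕ
    #links = count linksXG (crossingSets k S)

  missesLinks-bound : ∀ X F → 2 ^ (1 + 5 * n) * count (missesLinks X F) (T k S) ≤ length (T k S)
  missesLinks-bound X F with candidate X ∧ not (n ≤ᵇ 8 * ∣ F ∣) in guard
  ... | false rewrite count-none {p = λ _ → false} (λ _ ()) (T k S) | *-zeroʳ (2 ^ (1 + 5 * n)) = z≤n
  ... | true  =
    let X-candidate , n≰8∣F∣ = Equivalence.to T-∧ (subst Bool.T (sym guard) _)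
        X⊆W₁ , ∣X∣≡5k       = Equivalence.to T-∧ X-candidate
    in avoids-links-bound (T-does⁻ (X ⊆? W₁) X⊆W₁) (≡ᵇ⇒≡ _ _ ∣X∣≡5k) (≰⇒> (T-not⁻ n≰8∣F∣ ∘ ≤⇒≤ᵇ))

  witnessesFailure⇒missesLinks : ∀ X H → Bool.T (witnessesFailure X H) →
                                 Bool.T (missesLinks X (neighbourhood k H W₂ X) H)
  witnessesFailure⇒missesLinks X H w = Equivalence.from T-∧
    (subst (λ c → Bool.T (candidate X ∧ not (n ≤ᵇ 8 * c))) (sym (∣neighbourhood∣ k H W₂ X)) w ,
     avoids-links-outside-neighbourhood k H W₂ X)

  sideGood-fails⇒witness : ∀ H → Bool.T (not (sideGood k (5 * k) H W₁ W₂)) →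
                           Any (λ X → Bool.T (witnessesFailure X H)) (subsets n)
  sideGood-fails⇒witness H h = Any.map (λ {X} → T-not-if⁻ (candidate X)) (not-all⁻ _ (subsets n) h)

  side-bound : 2 ^ (1 + 5 * n) * count (λ H → not (sideGood k (5 * k) H W₁ W₂)) (T k S)
               ≤ length (subsets n) * (length (subsets n) * length (T k S))
  side-bound =
    union-bound (subsets n) witnessesFailure {M = 2 ^ (1 + 5 * n)} (T k S) sideGood-fails⇒witness λ {X} _ →
    union-bound (subsets n) (missesLinks X) {M = 2 ^ (1 + 5 * n)} (T k S)
      (λ H w → lose (∈-subsets (neighbourhood k H W₂ X)) (witnessesFailure⇒missesLinks X H w))
      (λ {F} _ → missesLinks-bound X F)

lemma5p5 : (k n : ℕ) (S : Subset n) → 3 ≤ k → n ≤ 4 * ∣ S ∣ → 2 * ∣ S ∣ ≤ n →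
    2 ^ (3 * n) * length (filterᵇ (λ H → not (Good k S H)) (T k S)) ≤ length (T k S)
lemma5p5 k n S 3≤k n≤4∣S∣ 2∣S∣≤n =
  2^[1+5n]c≤2[2ⁿ[2ⁿL]]⇒2^[3n]c≤L n
    (union-bound sides side-fails {M = 2 ^ (1 + 5 * n)} (T k S) Good-fails⇒side-fails bound)
  where
  sides : List (Subset n × Subset n)
  sides = (S , ∁ S) ∷ (∁ S , S) ∷ []
  side-fails : Subset n × Subset n → Hypergraph n → Bool
  side-fails (W₁ , W₂) H = not (sideGood k (5 * k) H W₁ W₂)
  Good-fails⇒side-fails : ∀ H → Bool.T (not (Good k S H)) → Any (λ W → Bool.T (side-fails W H)) sides
  Good-fails⇒side-fails H h with T-not-∧⁻ (sideGood k (5 * k) H S (∁ S)) h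
  ... | inj₁ S-side-fails  = here S-side-fails
  ... | inj₂ ∁S-side-fails = there (here ∁S-side-fails)
  bound : ∀ {W} → W ∈ₗ sides → 2 ^ (1 + 5 * n) * count (side-fails W) (T k S)
                                ≤ length (subsets n) * (length (subsets n) * length (T k S))
  bound (here refl) =
    SideBound.side-bound S S (∁ S) 3≤k (2∣p∣≤n⇒n≤4∣∁p∣ S 2∣S∣≤n) (∩-inverseʳ S) crossing⁺
  bound (there (here refl)) =
    SideBound.side-bound S (∁ S) S 3≤k n≤4∣S∣ (∩-inverseˡ S)
      λ ∣e∣≡k e∩∁S≢∅ e∩S≢∅ → crossing⁺ ∣e∣≡k e∩S≢∅ e∩∁S≢∅
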